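{- Let $X$ be a finite set. Let $\mathsf t_1=\mathsf S(H_1,R;w_1)$ and $\mathsf t_2=\mathsf S(H_2,R;w_2)$ be scaffolds whose diagrams $H_1,H_2$ have the same root list $R$, and suppose $\mathsf t_1=\mathsf t_2$. Let $r_1,\dots,r_\ell$ be distinct nodes in $R$. Let $\mathsf s=\mathsf S(G,P;w)$ be any scaffold whose diagram $G$ has node set disjoint from $V(H_1)\cup V(H_2)$, and let $u_1,\dots,u_\ell$ be distinct root nodes of $\mathsf s$. Let $\xi(u_i)=r_i$ for $1\le i\le \ell$ and $\xi(c)=c$ for the other nodes $c$ of $G$. Then $\mathsf s+_\xi\mathsf t_1=\mathsf s+_\xi\mathsf t_2$.
   Context: $V=\mathbb C^X$ has standard basis $\{\hat x:x\in X\}$. For a finite digraph $G$ (loops and multiple arcs allowed), a list $R=(r_1,\dots,r_m)$ of distinct nodes (roots) and $w:E(G)\to\mathsf{Mat}_X(\mathbb C)$, the scaffold is $\mathsf S(G,R;w)=\sum_{\varphi:V(G)\to X}\big(\prod_{e=(a,b)\in E(G)} w(e)_{\varphi(a),\varphi(b)}\big)\widehat{\varphi(r_1)}\otimes\cdots\otimes\widehat{\varphi(r_m)}$. Gluing: for scaffolds $\mathsf s=\mathsf S(G,P;w)$ and $\mathsf t=\mathsf S(H,R;w_H)$ and $\xi$ as in the claim, $\mathsf s+_\xi\mathsf t$ is the scaffold on the digraph $G+_\xi H$ with node set $(V(G)\setminus\{u_1,\dots,u_\ell\})\cup V(H)$ and arc set $E(H)\cup\{(\xi(a),\xi(b)):(a,b)\in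 E(G)\}$, each arc keeping its weight ($w_H$ on arcs of $H$, $w$ on images of arcs of $G$), and with root set the union of $R$ and $\{\xi(p):p\in P\}$ (each node listed once), in a fixed order that is the same when forming $\mathsf s+_\xi\mathsf t_1$ and $\mathsf s+_\xi\mathsf t_2$. -}

module Defs where

open import Level using (Level)
open import Algebra.Bundles using (CommutativeRing)
open import Data.Nat as ℕ using (ℕ)
open import Data.Fin using (Fin)
open import Data.Fin.Properties using () renaming (_≟_ to _≟F_)
open import Data.List using (List; []; _∷_; _++_; map; concatMap; filter; length; allFin)
open import Data.List.Membership.Propositional using (_∈_; _∉_)
open import Data.List.Membership.DecPropositional (ℕ._≟_) using (_∈?_)
open import Data.List.Relation.Unary.All using (All)
open import Data.List.Relation.Unary.Unique.Propositional using (Unique)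
open import Data.Vec using (Vec; []; _∷_)
open import Data.Maybe using (Maybe; just; nothing)
open import Data.Product using (_×_; _,_)
open import Relation.Nullary using (yes; no; ¬_)

-- The finite set X is Fin k.  Nodes of all digraphs are labelled by natural
-- numbers (a global supply of node names, so "disjoint node sets" makes sense).

-- A weighted digraph: a node list and a list of arcs (tail, head, weight matrix).
-- Loops and multiple arcs are allowed (arcs form a list).
record Digraph {a} (A : Set a) (k : ℕ) : Set a where
  constructor digraph
  field
    nodes : List ℕ
    arcs  : List (ℕ × ℕ × (Fin k → Fin k → A))
open Digraph public

WellFormed : ∀ {a} {A : Set a} {k} → Digraph A k → Set a
WellFormed G = Unique (nodes G) × All (λ { (x , y , _) → x ∈ nodes G × y ∈ nodes G }) (arcs G)

Roots : ∀ {a} {A : Set a} {k} → Digraph A k → List ℕ → Set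
Roots G R = Unique R × All (_∈ nodes G) R

Assign : ℕ → Set
Assign k = List (ℕ × Fin k)

allAssign : (k : ℕ) → List ℕ → List (Assign k)
allAssign k []       = [] ∷ []
allAssign k (v ∷ vs) = concatMap (λ φ → map (λ x → (v , x) ∷ φ) (allFin k)) (allAssign k vs)

lookupA : ∀ {k} → Assign k → ℕ → Maybe (Fin k)
lookupA []             v = nothing
lookupA ((u , x) ∷ φ) v with u ℕ.≟ v
... | yes _ = just x
... | no  _ = lookupA φ v

ξ : List ℕ → List ℕ → ℕ → ℕ
ξ (u ∷ us) (r ∷ rs) c with u ℕ.≟ c
... | yes _ = r
... | no  _ = ξ us rs c
ξ _ _ c = c

glue : ∀ {a} {A : Set a} {k} → Digraph A k → List ℕ → List ℕ → Digraph A k → Digraph A k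
glue G us rs H = digraph
  (nodes H ++ filter (λ c → ¬? (c ∈? us)) (nodes G))
  (arcs H ++ map (λ { (x , y , M) → (ξ us rs x , ξ us rs y , M) }) (arcs G))
  where open import Relation.Nullary.Decidable using (¬?)

glueRoots : List ℕ → List ℕ → List ℕ → List ℕ → List ℕ
glueRoots P us rs R = R ++ filter (λ c → ¬? (c ∈? R)) (map (ξ us rs) P)
  where open import Relation.Nullary.Decidable using (¬?)

module _ {c ℓ} (𝓡 : CommutativeRing c ℓ) where
  open CommutativeRing 𝓡

  sumR : List Carrier → Carrier
  sumR []       = 0#
  sumR (x ∷ xs) = x + sumR xs

  prodR : List Carrier → Carrier
  prodR []       = 1#
  prodR (x ∷ xs) = x * prodR xs

  arcWeight : ∀ {k} → Assign k → ℕ × ℕ × (Fin k → Fin k → Carrier) → Carrier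
  arcWeight φ (x , y , M) with lookupA φ x | lookupA φ y
  ... | just i | just j = M i j
  ... | _      | _      = 0#

  -- coefficient of \hat y_1 ⊗ ... ⊗ \hat y_m in \hat{φ(r_1)} ⊗ ... ⊗ \hat{φ(r_m)}
  rootCoeff : ∀ {k} → Assign k → (R : List ℕ) → Vec (Fin k) (length R) → Carrier
  rootCoeff φ []       []       = 1#
  rootCoeff φ (r ∷ R) (y ∷ ys) with lookupA φ r
  ... | nothing = 0#
  ... | just x with x ≟F y
  ...   | yes _ = rootCoeff φ R ys
  ...   | no  _ = 0#

  -- Scaffold S(G,R;w) ∈ V^{⊗ m}, given by its coordinates in the standard basis
  -- of V^{⊗ m} (indexed by y ∈ X^m, m = length R).
  scaffold : ∀ {k} → Digraph Carrier k → (R : List ℕ) → Vec (Fin k) (length R) → Carrier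
  scaffold {k} G R y =
    sumR (map (λ φ → prodR (map (arcWeight φ) (arcs G)) * rootCoeff φ R y)
              (allAssign k (nodes G)))

  _≋_ : ∀ {m k} → (Vec (Fin k) m → Carrier) → (Vec (Fin k) m → Carrier) → Set ℓ
  s ≋ t = ∀ y → s y ≈ t y

-- The glued digraph is H with extra nodes B, arcs A and roots E attached, where A and
-- E meet H only in R.  Summing first over the assignment φ of V(H) and then over the
-- assignment ψ of B, each summand splits as a summand of t = S(H,R;w) times an
-- exterior factor.  That factor sees φ only through φ|R, and wherever the root
-- coefficient of t is non-zero, φ|R equals the root indices y|R; so it depends on ψ
-- and y alone, and the glued scaffold is Σ_ψ t(y|R) · exterior(ψ), a function of t.
module Submission where

open import Defs
open import Algebra.Bundles using (CommutativeRing)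
open import Data.Nat as ℕ using (ℕ)
open import Data.Fin using (Fin)
open import Data.Fin.Properties using () renaming (_≟_ to _≟F_)
open import Data.List using (List; []; _∷_; _++_; map; concatMap; filter; length; allFin)
open import Data.List.Properties using (map-++; map-∘)
open import Data.List.Membership.Propositional using (_∈_; _∉_)
open import Data.List.Membership.DecPropositional (ℕ._≟_) using (_∈?_)
open import Data.List.Relation.Unary.Any using (here; there)
open import Data.List.Relation.Unary.All as All using (All; []; _∷_)
import Data.List.Relation.Unary.All.Properties as All
open import Data.List.Relation.Unary.Unique.Propositional using (Unique)
open import Data.Vec using (Vec; []; _∷_)
open import Data.Maybe using (just; nothing)
open import Data.Product using (_×_; _,_; proj₁; proj₂)
open import Data.Sum using (_⊎_; inj₁; inj₂)
open import Data.Empty using (⊥-elim)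
open import Function using (_∘_)
open import Relation.Nullary using (yes; no; ¬_)
open import Relation.Nullary.Decidable using (¬?)
open import Relation.Binary.PropositionalEquality using (_≡_; refl; sym; trans; cong; cong₂; subst)

Ends : ∀ {a} {A : Set a} → (ℕ → Set) → ℕ × ℕ × A → Set
Ends P (x , y , _) = P x × P y

attach : ∀ {a} {A : Set a} {k} → Digraph A k → List ℕ → List (ℕ × ℕ × (Fin k → Fin k → A)) → Digraph A k
attach H nodes′ arcs′ = digraph (nodes H ++ nodes′) (arcs H ++ arcs′)

module _ {k : ℕ} where

  dom : Assign k → List ℕ
  dom = map proj₁

  allAssign-dom : ∀ A → All (λ φ → dom φ ≡ A) (allAssign k A)
  allAssign-dom []      = refl ∷ []
  allAssign-dom (v ∷ A) = All.concat⁺ (All.map⁺ (All.map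
    (λ dom≡A → All.map⁺ (All.tabulate (λ _ → cong (v ∷_) dom≡A))) (allAssign-dom A)))

  lookupA-++-∈ : ∀ (φ ψ : Assign k) {N v} → dom φ ≡ N → v ∈ N → lookupA (φ ++ ψ) v ≡ lookupA φ v
  lookupA-++-∈ ((u , _) ∷ φ) ψ {v = v} refl v∈ with u ℕ.≟ v
  ... | yes _ = refl
  ... | no u≢v with v∈
  ...   | here refl = ⊥-elim (u≢v refl)
  ...   | there v∈φ = lookupA-++-∈ φ ψ refl v∈φ

  lookupA-++-∉ : ∀ (φ ψ : Assign k) {N v} → dom φ ≡ N → v ∉ N → lookupA (φ ++ ψ) v ≡ lookupA ψ v
  lookupA-++-∉ []            ψ         refl v∉ = refl
  lookupA-++-∉ ((u , _) ∷ φ) ψ {v = v} refl v∉ with u ℕ.≟ v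
  ... | yes refl = ⊥-elim (v∉ (here refl))
  ... | no _     = lookupA-++-∉ φ ψ refl (v∉ ∘ there)

  assignRoots : (R : List ℕ) → Vec (Fin k) (length R) → Assign k
  assignRoots []      []       = []
  assignRoots (r ∷ R) (y ∷ ys) = (r , y) ∷ assignRoots R ys

  assignRoots-dom : ∀ R y → dom (assignRoots R y) ≡ R
  assignRoots-dom []      []       = refl
  assignRoots-dom (r ∷ R) (y ∷ ys) = cong (r ∷_) (assignRoots-dom R ys)

  splitˡ : (R E : List ℕ) → Vec (Fin k) (length (R ++ E)) → Vec (Fin k) (length R)
  splitˡ []      E y        = []
  splitˡ (r ∷ R) E (y ∷ ys) = y ∷ splitˡ R E ys

  splitʳ : (R E : List ℕ) → Vec (Fin k) (length (R ++ E)) → Vec (Fin k) (length E)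
  splitʳ []      E y        = y
  splitʳ (r ∷ R) E (y ∷ ys) = splitʳ R E ys

ξ-∈-or-id : ∀ {R rs} → All (_∈ R) rs → ∀ us x → ξ us rs x ∈ R ⊎ ξ us rs x ≡ x
ξ-∈-or-id []       []       x = inj₂ refl
ξ-∈-or-id (_ ∷ _)  []       x = inj₂ refl
ξ-∈-or-id []       (u ∷ us) x = inj₂ refl
ξ-∈-or-id (r∈R ∷ rs⊆R) (u ∷ us) x with u ℕ.≟ x
... | yes _ = inj₁ r∈R
... | no _  = ξ-∈-or-id rs⊆R us x

module _ {c ℓ} (𝓡 : CommutativeRing c ℓ) where
  open CommutativeRing 𝓡 renaming (refl to ≈-refl; sym to ≈-sym; trans to ≈-trans)
  open import Algebra.Properties.CommutativeSemigroup *-commutativeSemigroup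
    using (interchange; uv≈wx⇒yu∙vz≈yw∙xz)
  open import Relation.Binary.Reasoning.Setoid setoid

  private
    Σ = sumR 𝓡
    Π = prodR 𝓡

  sumR-++ : ∀ xs ys → Σ (xs ++ ys) ≈ Σ xs + Σ ys
  sumR-++ []       ys = ≈-sym (+-identityˡ _)
  sumR-++ (x ∷ xs) ys = ≈-trans (+-congˡ (sumR-++ xs ys)) (≈-sym (+-assoc _ _ _))

  prodR-++ : ∀ xs ys → Π (xs ++ ys) ≈ Π xs * Π ys
  prodR-++ []       ys = ≈-sym (*-identityˡ _)
  prodR-++ (x ∷ xs) ys = ≈-trans (*-congˡ (prodR-++ xs ys)) (≈-sym (*-assoc _ _ _))

  sumR-congᴬ : ∀ {A : Set} {P : A → Set} {f g : A → Carrier} {xs} →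
    All P xs → (∀ {x} → P x → f x ≈ g x) → Σ (map f xs) ≈ Σ (map g xs)
  sumR-congᴬ []         f≈g = ≈-refl
  sumR-congᴬ (px ∷ pxs) f≈g = +-cong (f≈g px) (sumR-congᴬ pxs f≈g)

  sumR-cong : ∀ {A : Set} {f g : A → Carrier} xs → (∀ x → f x ≈ g x) → Σ (map f xs) ≈ Σ (map g xs)
  sumR-cong []       f≈g = ≈-refl
  sumR-cong (x ∷ xs) f≈g = +-cong (f≈g x) (sumR-cong xs f≈g)

  sumR-*ʳ : ∀ {A : Set} (f : A → Carrier) a xs → Σ (map (λ x → f x * a) xs) ≈ Σ (map f xs) * a
  sumR-*ʳ f a []       = ≈-sym (zeroˡ a)
  sumR-*ʳ f a (x ∷ xs) = ≈-trans (+-congˡ (sumR-*ʳ f a xs)) (≈-sym (distribʳ a _ _))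

  sumR-concatMap : ∀ {A B : Set} (f : B → Carrier) (g : A → List B) xs →
    Σ (map f (concatMap g xs)) ≈ Σ (map (λ x → Σ (map f (g x))) xs)
  sumR-concatMap f g []       = ≈-refl
  sumR-concatMap f g (x ∷ xs) = begin
    Σ (map f (g x ++ concatMap g xs))             ≡⟨ cong Σ (map-++ f (g x) _) ⟩
    Σ (map f (g x) ++ map f (concatMap g xs))     ≈⟨ sumR-++ (map f (g x)) _ ⟩
    Σ (map f (g x)) + Σ (map f (concatMap g xs))  ≈⟨ +-congˡ (sumR-concatMap f g xs) ⟩
    Σ (map (λ x → Σ (map f (g x))) (x ∷ xs))      ∎

  module _ {k : ℕ} where

    sumR-allAssign-∷ : ∀ v A (F : Assign k → Carrier) →
      Σ (map F (allAssign k (v ∷ A))) ≈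
      Σ (map (λ φ → Σ (map (λ x → F ((v , x) ∷ φ)) (allFin k))) (allAssign k A))
    sumR-allAssign-∷ v A F = ≈-trans (sumR-concatMap F _ (allAssign k A))
      (sumR-cong (allAssign k A) (λ φ → reflexive (cong Σ (sym (map-∘ (allFin k))))))

    sumR-allAssign-++ : ∀ A B (F : Assign k → Carrier) →
      Σ (map F (allAssign k (A ++ B))) ≈
      Σ (map (λ ψ → Σ (map (λ φ → F (φ ++ ψ)) (allAssign k A))) (allAssign k B))
    sumR-allAssign-++ []      B F = sumR-cong (allAssign k B) (λ ψ → ≈-sym (+-identityʳ _))
    sumR-allAssign-++ (v ∷ A) B F = begin
      Σ (map F (allAssign k (v ∷ A ++ B)))
        ≈⟨ sumR-allAssign-∷ v (A ++ B) F ⟩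
      Σ (map (λ φ → Σ (map (λ x → F ((v , x) ∷ φ)) (allFin k))) (allAssign k (A ++ B)))
        ≈⟨ sumR-allAssign-++ A B _ ⟩
      Σ (map (λ ψ → Σ (map (λ φ → Σ (map (λ x → F ((v , x) ∷ φ ++ ψ)) (allFin k))) (allAssign k A)))
             (allAssign k B))
        ≈⟨ sumR-cong (allAssign k B) (λ ψ → ≈-sym (sumR-allAssign-∷ v A (λ φ → F (φ ++ ψ)))) ⟩
      Σ (map (λ ψ → Σ (map (λ φ → F (φ ++ ψ)) (allAssign k (v ∷ A)))) (allAssign k B)) ∎

    arcWeight-local : ∀ {φ φ′ : Assign k} {x y} (M : Fin k → Fin k → Carrier) →
      lookupA φ x ≡ lookupA φ′ x → lookupA φ y ≡ lookupA φ′ y →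
      arcWeight 𝓡 φ (x , y , M) ≡ arcWeight 𝓡 φ′ (x , y , M)
    arcWeight-local M eqx eqy rewrite eqx | eqy = refl

    Arc : Set c
    Arc = ℕ × ℕ × (Fin k → Fin k → Carrier)

    arcsWeight : Assign k → List Arc → Carrier
    arcsWeight φ A = Π (map (arcWeight 𝓡 φ) A)

    arcsWeight-local : ∀ (φ φ′ : Assign k) {A} →
      All (Ends (λ v → lookupA φ v ≡ lookupA φ′ v)) A → arcsWeight φ A ≡ arcsWeight φ′ A
    arcsWeight-local φ φ′ []                 = refl
    arcsWeight-local φ φ′ {(_ , _ , M) ∷ _} ((eqx , eqy) ∷ eqs) =
      cong₂ _*_ (arcWeight-local {φ} {φ′} M eqx eqy) (arcsWeight-local φ φ′ eqs)

    arcsWeight-++ : ∀ φ A A′ → arcsWeight φ (A ++ A′) ≈ arcsWeight φ A * arcsWeight φ A′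
    arcsWeight-++ φ A A′ =
      ≈-trans (reflexive (cong Π (map-++ (arcWeight 𝓡 φ) A A′))) (prodR-++ (map (arcWeight 𝓡 φ) A) _)

    rootCoeff-local : ∀ {φ φ′ : Assign k} R (y : Vec (Fin k) (length R)) →
      All (λ r → lookupA φ r ≡ lookupA φ′ r) R → rootCoeff 𝓡 φ R y ≡ rootCoeff 𝓡 φ′ R y
    rootCoeff-local []      []       []                 = refl
    rootCoeff-local {φ′ = φ′} (r ∷ R) (y ∷ ys) (eq ∷ eqs) rewrite eq with lookupA φ′ r
    ... | nothing = refl
    ... | just x with x ≟F y
    ...   | yes _ = rootCoeff-local R ys eqs
    ...   | no _  = refl

    rootCoeff-++ : ∀ (φ : Assign k) R E y →
      rootCoeff 𝓡 φ (R ++ E) y ≈ rootCoeff 𝓡 φ R (splitˡ R E y) * rootCoeff 𝓡 φ E (splitʳ R E y)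
    rootCoeff-++ φ []      E y        = ≈-sym (*-identityˡ _)
    rootCoeff-++ φ (r ∷ R) E (y ∷ ys) with lookupA φ r
    ... | nothing = ≈-sym (zeroˡ _)
    ... | just x with x ≟F y
    ...   | yes _ = rootCoeff-++ φ R E ys
    ...   | no _  = ≈-sym (zeroˡ _)

    rootCoeff-≈0-or-agrees : ∀ (φ : Assign k) R y →
      rootCoeff 𝓡 φ R y ≈ 0# ⊎ (∀ {v} → v ∈ R → lookupA φ v ≡ lookupA (assignRoots R y) v)
    rootCoeff-≈0-or-agrees φ []      []       = inj₂ (λ ())
    rootCoeff-≈0-or-agrees φ (r ∷ R) (y ∷ ys) with lookupA φ r in φr
    ... | nothing = inj₁ ≈-refl
    ... | just x with x ≟F y
    ...   | no _  = inj₁ ≈-refl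
    ...   | yes refl with rootCoeff-≈0-or-agrees φ R ys
    ...     | inj₁ ≈0    = inj₁ ≈0
    ...     | inj₂ agree = inj₂ agree′
      where
      agree′ : ∀ {v} → v ∈ r ∷ R → lookupA φ v ≡ lookupA (assignRoots (r ∷ R) (x ∷ ys)) v
      agree′ {v} v∈ with r ℕ.≟ v
      ... | yes refl = φr
      ... | no r≢v with v∈
      ...   | here refl = ⊥-elim (r≢v refl)
      ...   | there v∈R = agree v∈R

    arcsWeight-pinned : ∀ (φ ψ : Assign k) {N} R y A → dom φ ≡ N → All (_∈ N) R →
      All (Ends (λ v → v ∈ R ⊎ v ∉ N)) A →
      rootCoeff 𝓡 φ R y * arcsWeight (φ ++ ψ) A ≈ rootCoeff 𝓡 φ R y * arcsWeight (assignRoots R y ++ ψ) A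
    arcsWeight-pinned φ ψ {N} R y A domφ R⊆N A⊆R∪N̅ with rootCoeff-≈0-or-agrees φ R y
    ... | inj₁ ≈0 = ≈-trans (annihilated _) (≈-sym (annihilated _))
      where
      annihilated : ∀ a → rootCoeff 𝓡 φ R y * a ≈ 0#
      annihilated a = ≈-trans (*-congʳ ≈0) (zeroˡ a)
    ... | inj₂ agree = *-congˡ (reflexive (arcsWeight-local (φ ++ ψ) (assignRoots R y ++ ψ)
            (All.map (λ { {_ , _ , _} (p , q) → same p , same q }) A⊆R∪N̅)))
      where
      z = assignRoots R y
      same : ∀ {v} → v ∈ R ⊎ v ∉ N → lookupA (φ ++ ψ) v ≡ lookupA (z ++ ψ) v
      same (inj₁ v∈R) = trans (lookupA-++-∈ φ ψ domφ (All.lookup R⊆N v∈R))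
        (trans (agree v∈R) (sym (lookupA-++-∈ z ψ (assignRoots-dom R y) v∈R)))
      same (inj₂ v∉N) = trans (lookupA-++-∉ φ ψ domφ v∉N)
        (sym (lookupA-++-∉ z ψ (assignRoots-dom R y) (v∉N ∘ All.lookup R⊆N)))

    exterior : (R : List ℕ) → List Arc → (E : List ℕ) → Vec (Fin k) (length (R ++ E)) → Assign k → Carrier
    exterior R A E y ψ = arcsWeight (assignRoots R (splitˡ R E y) ++ ψ) A * rootCoeff 𝓡 ψ E (splitʳ R E y)

    module _ (H : Digraph Carrier k) (R B : List ℕ) (A : List Arc) (E : List ℕ)
      (arcsH⊆H : All (Ends (_∈ nodes H)) (arcs H)) (R⊆H : All (_∈ nodes H) R)
      (A⊆R∪H̅ : All (Ends (λ v → v ∈ R ⊎ v ∉ nodes H)) A) (E⊆H̅ : All (_∉ nodes H) E)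
      (y : Vec (Fin k) (length (R ++ E))) where

      private
        y₁ = splitˡ R E y
        y₂ = splitʳ R E y

      summand-factorises : ∀ φ ψ → dom φ ≡ nodes H →
        arcsWeight (φ ++ ψ) (arcs H ++ A) * rootCoeff 𝓡 (φ ++ ψ) (R ++ E) y ≈
        (arcsWeight φ (arcs H) * rootCoeff 𝓡 φ R y₁) * exterior R A E y ψ
      summand-factorises φ ψ domφ = begin
        arcsWeight φψ (arcs H ++ A) * rootCoeff 𝓡 φψ (R ++ E) y
          ≈⟨ *-cong (arcsWeight-++ φψ (arcs H) A) (rootCoeff-++ φψ R E y) ⟩
        (arcsWeight φψ (arcs H) * arcsWeight φψ A) * (rootCoeff 𝓡 φψ R y₁ * rootCoeff 𝓡 φψ E y₂)
          ≡⟨ cong₂ (λ a b → (a * arcsWeight φψ A) * b)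
               (arcsWeight-local φψ φ (All.map (λ { {_ , _ , _} (p , q) → inside p , inside q }) arcsH⊆H))
               (cong₂ _*_ (rootCoeff-local R y₁ (All.map inside R⊆H))
                          (rootCoeff-local E y₂ (All.map outside E⊆H̅))) ⟩
        (arcsWeight φ (arcs H) * arcsWeight φψ A) * (rootCoeff 𝓡 φ R y₁ * rootCoeff 𝓡 ψ E y₂)
          ≈⟨ interchange _ _ _ _ ⟩
        (arcsWeight φ (arcs H) * rootCoeff 𝓡 φ R y₁) * (arcsWeight φψ A * rootCoeff 𝓡 ψ E y₂)
          ≈⟨ uv≈wx⇒yu∙vz≈yw∙xz (arcsWeight-pinned φ ψ R y₁ A domφ R⊆H A⊆R∪H̅) _ _ ⟩
        (arcsWeight φ (arcs H) * rootCoeff 𝓡 φ R y₁) * exterior R A E y ψ ∎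
        where
        φψ = φ ++ ψ
        inside : ∀ {v} → v ∈ nodes H → lookupA φψ v ≡ lookupA φ v
        inside = lookupA-++-∈ φ ψ domφ
        outside : ∀ {v} → v ∉ nodes H → lookupA φψ v ≡ lookupA ψ v
        outside = lookupA-++-∉ φ ψ domφ

      scaffold-attach : scaffold 𝓡 (attach H B A) (R ++ E) y ≈
        Σ (map (λ ψ → scaffold 𝓡 H R y₁ * exterior R A E y ψ) (allAssign k B))
      scaffold-attach = begin
        scaffold 𝓡 (attach H B A) (R ++ E) y
          ≈⟨ sumR-allAssign-++ (nodes H) B _ ⟩
        Σ (map (λ ψ → Σ (map (λ φ → arcsWeight (φ ++ ψ) (arcs H ++ A) * rootCoeff 𝓡 (φ ++ ψ) (R ++ E) y)
                             (allAssign k (nodes H))))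
               (allAssign k B))
          ≈⟨ sumR-cong (allAssign k B) (λ ψ → ≈-trans
               (sumR-congᴬ (allAssign-dom (nodes H)) (summand-factorises _ ψ))
               (sumR-*ʳ _ (exterior R A E y ψ) (allAssign k (nodes H)))) ⟩
        Σ (map (λ ψ → scaffold 𝓡 H R y₁ * exterior R A E y ψ) (allAssign k B)) ∎

    scaffold-attach-cong : ∀ {H₁ H₂ : Digraph Carrier k} {R} B A E →
      _≋_ 𝓡 (scaffold 𝓡 H₁ R) (scaffold 𝓡 H₂ R) →
      All (Ends (_∈ nodes H₁)) (arcs H₁) → All (Ends (_∈ nodes H₂)) (arcs H₂) →
      All (_∈ nodes H₁) R → All (_∈ nodes H₂) R →
      All (Ends (λ v → v ∈ R ⊎ v ∉ nodes H₁)) A → All (Ends (λ v → v ∈ R ⊎ v ∉ nodes H₂)) A →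
      All (_∉ nodes H₁) E → All (_∉ nodes H₂) E →
      _≋_ 𝓡 (scaffold 𝓡 (attach H₁ B A) (R ++ E)) (scaffold 𝓡 (attach H₂ B A) (R ++ E))
    scaffold-attach-cong {H₁} {H₂} {R} B A E t₁≋t₂ arcs₁ arcs₂ R⊆H₁ R⊆H₂ A₁ A₂ E₁ E₂ y = begin
      scaffold 𝓡 (attach H₁ B A) (R ++ E) y
        ≈⟨ scaffold-attach H₁ R B A E arcs₁ R⊆H₁ A₁ E₁ y ⟩
      Σ (map (λ ψ → scaffold 𝓡 H₁ R (splitˡ R E y) * exterior R A E y ψ) (allAssign k B))
        ≈⟨ sumR-cong (allAssign k B) (λ ψ → *-congʳ (t₁≋t₂ (splitˡ R E y))) ⟩
      Σ (map (λ ψ → scaffold 𝓡 H₂ R (splitˡ R E y) * exterior R A E y ψ) (allAssign k B))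
        ≈⟨ scaffold-attach H₂ R B A E arcs₂ R⊆H₂ A₂ E₂ y ⟨
      scaffold 𝓡 (attach H₂ B A) (R ++ E) y ∎

module _ {R rs : List ℕ} (rs⊆R : All (_∈ R) rs) (us : List ℕ) {V N : List ℕ} (V⊆N̅ : All (_∉ N) V) where

  ξ-avoids : ∀ {x} → x ∈ V → ξ us rs x ∈ R ⊎ ξ us rs x ∉ N
  ξ-avoids {x} x∈V with ξ-∈-or-id rs⊆R us x
  ... | inj₁ ξx∈R = inj₁ ξx∈R
  ... | inj₂ ξx≡x = inj₂ (λ ξx∈N → All.lookup V⊆N̅ x∈V (subst (_∈ N) ξx≡x ξx∈N))

  glued-arcs-avoid : ∀ {a} {A : Set a} {arcs′ : List (ℕ × ℕ × A)} → All (Ends (_∈ V)) arcs′ →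
    All (Ends (λ v → v ∈ R ⊎ v ∉ N)) (map (λ { (x , y , M) → (ξ us rs x , ξ us rs y , M) }) arcs′)
  glued-arcs-avoid arcs⊆V =
    All.map⁺ (All.map (λ { {_ , _ , _} (x∈V , y∈V) → ξ-avoids x∈V , ξ-avoids y∈V }) arcs⊆V)

  glued-roots-avoid : ∀ {P} → All (_∈ V) P → All (_∉ N) (filter (λ c → ¬? (c ∈? R)) (map (ξ us rs) P))
  glued-roots-avoid {P} P⊆V = All.map outside
    (All.zip (All.filter⁺ _ (All.map⁺ (All.map ξ-avoids P⊆V)) , All.all-filter _ (map (ξ us rs) P)))
    where
    outside : ∀ {v} → (v ∈ R ⊎ v ∉ N) × ¬ v ∈ R → v ∉ N
    outside (inj₁ v∈R , v∉R) = ⊥-elim (v∉R v∈R)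
    outside (inj₂ v∉N , _)   = v∉N

-- glue G us rs H unfolds to attach H B A (B the nodes of G outside us, A the ξ-images of
-- the arcs of G) with root list R ++ E.
proposition1p5 : ∀ {c ℓ} (𝓡 : CommutativeRing c ℓ) (k : ℕ)
    (H₁ H₂ : Digraph (CommutativeRing.Carrier 𝓡) k) (R : List ℕ)
    → WellFormed H₁ → WellFormed H₂ → Roots H₁ R → Roots H₂ R
    → _≋_ 𝓡 (scaffold 𝓡 H₁ R) (scaffold 𝓡 H₂ R)
    → (rs : List ℕ) → Unique rs → All (_∈ R) rs
    → (G : Digraph (CommutativeRing.Carrier 𝓡) k) (P : List ℕ)
    → WellFormed G → Roots G P
    → All (λ v → v ∉ nodes H₁ × v ∉ nodes H₂) (nodes G)
    → (us : List ℕ) → Unique us → All (_∈ P) us → length us ≡ length rs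
    → _≋_ 𝓡 (scaffold 𝓡 (glue G us rs H₁) (glueRoots P us rs R))
            (scaffold 𝓡 (glue G us rs H₂) (glueRoots P us rs R))
proposition1p5 𝓡 k H₁ H₂ R (_ , arcs₁) (_ , arcs₂) (_ , R⊆H₁) (_ , R⊆H₂) t₁≋t₂ rs _ rs⊆R
               G P (_ , arcsG) (_ , P⊆G) G∉H us _ _ _ =
  scaffold-attach-cong 𝓡 _ _ _ t₁≋t₂ arcs₁ arcs₂ R⊆H₁ R⊆H₂
    (glued-arcs-avoid rs⊆R us G∉H₁ arcsG) (glued-arcs-avoid rs⊆R us G∉H₂ arcsG)
    (glued-roots-avoid rs⊆R us G∉H₁ P⊆G) (glued-roots-avoid rs⊆R us G∉H₂ P⊆G)
  where
  G∉H₁ = All.map proj₁ G∉H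
  G∉H₂ = All.map proj₂ G∉H
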